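{- Let $G$ be a finite abelian group of order $n$ (identity $e$) such that the generalized dihedral group $D(G)$ is non-abelian, let $r\ge0$ satisfy $2^r=|\{g\in G:g^2=e\}|$, let $\Gamma=\mathfrak{C}(D(G),D(G))$, and let $\Omega_1=\{(g,1):g^2=e\}$, $\Omega_2=\{(g,1):g\in G\}\setminus\Omega_1$, $\Omega_3=\{(g,-1):g\in G\}$. Then for each $v\in\Omega_1$, \[ecc_D(v)=\begin{cases}2n-1 & \text{if } \frac{n}{2^r}<2^r,\\ n+2^r(2^r-1)-1 & \text{if } \frac{n}{2^r}\ge 2^r,\end{cases}\] and for each $v\in\Omega_2\cup\Omega_3$, \[ecc_D(v)=\begin{cases}2n-1 & \text{if } \frac{n}{2^r}\le 2^r,\\ n+4^r-1 & \text{if } \frac{n}{2^r}> 2^r.\end{cases}\]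
   Context: $D(G)=G\rtimes C_2$, $C_2=\{1,-1\}$, has elements $(g,c)$ with multiplication $(g_1,c_1)(g_2,c_2)=(g_1g_2^{c_1},c_1c_2)$. The commuting graph $\mathfrak{C}(D(G),D(G))$ is the simple graph with vertex set $D(G)$ in which distinct $u,v$ are adjacent iff $uv=vu$. The detour distance $d_D(u,v)$ is the length (number of edges) of a longest $u$–$v$ path; the detour eccentricity $ecc_D(v)$ is $\max_{u} d_D(v,u)$ over vertices $u$ of the graph. -}

module Defs where

open import Data.Nat using (ℕ; suc; _≤_)
open import Data.Fin using (Fin)
open import Data.Fin.Properties using (_≟_)
open import Data.Bool using (Bool; true; false; not)
open import Data.Product using (_×_; _,_; ∃; ∃-syntax)
open import Data.List using (List; []; _∷_; length; filter; allFin)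
open import Data.List.Relation.Unary.Unique.Propositional using (Unique)
open import Relation.Binary.PropositionalEquality using (_≡_; _≢_)
open import Relation.Nullary using (¬_)

-- A finite group of order n is (up to isomorphism) a group structure on Fin n.
-- Elements of C₂ = {1,-1} are encoded as Bool: true = 1, false = -1.
module Dihedral {n : ℕ} (_∙_ : Fin n → Fin n → Fin n) (e : Fin n) (_⁻¹ : Fin n → Fin n) where

  _·₂_ : Bool → Bool → Bool
  true  ·₂ c = c
  false ·₂ c = not c

  _^₂_ : Fin n → Bool → Fin n
  g ^₂ true  = g
  g ^₂ false = g ⁻¹

  D : Set
  D = Fin n × Bool

  _⊙_ : D → D → D
  (g₁ , c₁) ⊙ (g₂ , c₂) = (g₁ ∙ (g₂ ^₂ c₁)) , (c₁ ·₂ c₂)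

  NonAbelianD : Set
  NonAbelianD = ∃[ u ] ∃[ v ] (u ⊙ v ≢ v ⊙ u)

  involCount : ℕ
  involCount = length (filter (λ g → (g ∙ g) ≟ e) (allFin n))

  Adj : D → D → Set
  Adj u v = (u ≢ v) × (u ⊙ v ≡ v ⊙ u)

  data Walk : D → D → Set where
    stop : ∀ {u} → Walk u u
    step : ∀ {u w v} → Adj u w → Walk w v → Walk u v

  verts : ∀ {u v} → Walk u v → List D
  verts {u} stop       = u ∷ []
  verts {u} (step _ w) = u ∷ verts w

  len : ∀ {u v} → Walk u v → ℕ
  len stop       = 0
  len (step _ w) = suc (len w)

  IsPath : ∀ {u v} → Walk u v → Set
  IsPath w = Unique (verts w)

  IsDetourDist : D → D → ℕ → Set
  IsDetourDist u v k =
    (∃[ p ] (IsPath {u} {v} p × len p ≡ k)) ×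
    (∀ (p : Walk u v) → IsPath p → len p ≤ k)

  IsDetourEcc : D → ℕ → Set
  IsDetourEcc v k =
    (∃[ u ] IsDetourDist v u k) ×
    (∀ u k′ → IsDetourDist v u k′ → k′ ≤ k)

module Submission where

-- Let K = {g : g² = e}, m = |K| = 2^r.  Ω₁ = {(g,1) : g ∈ K} is central, rotations
-- commute, no rotation outside K commutes with a reflection, and (g,-1),(h,-1)
-- commute iff g² = h²; so the reflections form n/m cliques ("classes", cosets of K).
-- Upper bound (a census of a path): at most n rotations, at most m in Ω₁; every
-- block of consecutive reflections lies in one class, and every block but a leading
-- one, as well as a visit to Ω₂ from outside, is entered from its own Ω₁ vertex.
-- This gives n + m(m-1) vertices from Ω₁, n + m² from Ω₂ ∪ Ω₃, and trivially 2n.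
-- Lower bound: all rotations followed by "central rotation, whole class" pairs (for
-- a reflection: its class first), with as many classes as both n/m and the spare
-- central rotations allow; the greedy choice of classes also shows m ∣ n.

open import Defs
open import Data.Nat using (ℕ; zero; suc; _+_; _*_; _∸_; _^_; _<_; _≤_; z≤n; s≤s; z<s; NonZero; >-nonZero)
open import Data.Nat.Properties hiding (_≟_)
open import Data.Fin using (Fin)
open import Data.Fin.Properties using (_≟_)
open import Data.Bool using (true; false; if_then_else_)
open import Data.Product using (_×_; _,_; ∃-syntax; Σ; proj₁; proj₂)
open import Data.Sum using (_⊎_; inj₁; inj₂)
import Data.Sum as Sum
open import Data.Empty using (⊥)
open import Data.Unit using (⊤; tt)
open import Data.Maybe using (Maybe; just; nothing)
open import Data.List using (List; []; _∷_; _++_; length; map; filter; take; drop; head; allFin)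
open import Data.List.Properties
  using (length-++; length-++-≤ʳ; length-map; length-take; length-drop; length-tabulate;
         take++drop≡id; take-map; map-++; filter-++; filter-all; filter-notAll; ++-assoc; ++-identityʳ)
open import Data.List.Membership.Propositional using (_∈_; _∉_)
open import Data.List.Membership.Propositional.Properties
  using (∈-filter⁺; ∈-filter⁻; ∈-map⁺; ∈-map⁻; ∈-++⁺ˡ; ∈-++⁺ʳ; ∈-++⁻; ∈-allFin)
open import Data.List.Relation.Binary.Subset.Propositional using (_⊆_)
open import Data.List.Relation.Unary.Any using (here; there)
import Data.List.Relation.Unary.Any as Any
open import Data.List.Relation.Unary.All using (All; []; _∷_)
import Data.List.Relation.Unary.All as All
import Data.List.Relation.Unary.All.Properties as All
open import Data.List.Relation.Unary.AllPairs using ([]; _∷_)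
open import Data.List.Relation.Unary.Unique.Propositional using (Unique)
import Data.List.Relation.Unary.Unique.Propositional.Properties as Unique
open import Data.List.Relation.Unary.Linked using (Linked; []; [-]; _∷_; _∷′_)
import Data.List.Relation.Unary.Linked.Properties as Linked
open import Data.Maybe.Relation.Binary.Connected using (Connected; just; just-nothing; nothing-just; nothing)
open import Algebra.Bundles using (AbelianGroup)
open import Algebra.Structures using (IsAbelianGroup)
import Algebra.Properties.Group as GroupProperties
import Algebra.Properties.CommutativeSemigroup as CommutativeSemigroupProperties
open import Relation.Nullary using (¬_; does; yes; no; ¬?; contradiction)
open import Relation.Binary.Definitions using (DecidableEquality)
open import Relation.Binary.PropositionalEquality
open import Data.Nat.Tactic.RingSolver using (solve-∀)

module Removal {A : Set} (_≟ᴬ_ : DecidableEquality A) where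

  remove : A → List A → List A
  remove x = filter (λ y → ¬? (y ≟ᴬ x))

  ∈-remove⁺ : ∀ {x y ys} → y ∈ ys → y ≢ x → y ∈ remove x ys
  ∈-remove⁺ {x} = ∈-filter⁺ (λ y → ¬? (y ≟ᴬ x))

  remove-⊆ : ∀ {x} ys → remove x ys ⊆ ys
  remove-⊆ {x} ys y∈ = proj₁ (∈-filter⁻ (λ y → ¬? (y ≟ᴬ x)) {xs = ys} y∈)

  ∉-remove : ∀ {x} ys → x ∉ remove x ys
  ∉-remove {x} ys x∈ = proj₂ (∈-filter⁻ (λ y → ¬? (y ≟ᴬ x)) {xs = ys} x∈) refl

  length-remove< : ∀ {x} ys → x ∈ ys → length (remove x ys) < length ys
  length-remove< {x} ys x∈ =
    filter-notAll (λ y → ¬? (y ≟ᴬ x)) ys (Any.map (λ x≡y y≢x → y≢x (sym x≡y)) x∈)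

  unique⊆⇒length≤ : ∀ {xs ys} → Unique xs → xs ⊆ ys → length xs ≤ length ys
  unique⊆⇒length≤ {[]} _ _ = z≤n
  unique⊆⇒length≤ {x ∷ xs} {ys} (x∉xs ∷ u) xs⊆ys =
    ≤-trans (s≤s (unique⊆⇒length≤ u tail⊆)) (length-remove< ys (xs⊆ys (here refl)))
    where
    tail⊆ : xs ⊆ remove x ys
    tail⊆ y∈ = ∈-remove⁺ (xs⊆ys (there y∈)) (λ y≡x → All.lookup x∉xs y∈ (sym y≡x))

  length-remove : ∀ {x ys} → Unique ys → x ∈ ys → suc (length (remove x ys)) ≡ length ys
  length-remove {x} {ys} u x∈ = ≤-antisym (length-remove< ys x∈) (unique⊆⇒length≤ u covered)
    where
    covered : ys ⊆ x ∷ remove x ys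
    covered {y} y∈ with y ≟ᴬ x
    ... | yes refl = here refl
    ... | no y≢x = there (∈-remove⁺ y∈ y≢x)

  unique-∷-remove : ∀ {x ys} → Unique ys → Unique (x ∷ remove x ys)
  unique-∷-remove {x} {ys} u =
    All.tabulate (λ y∈ x≡y → ∉-remove ys (subst (_∈ remove x ys) (sym x≡y) y∈))
    ∷ Unique.filter⁺ (λ y → ¬? (y ≟ᴬ x)) u

module Split {A : Set} where

  suffixOfLength : ∀ j (xs : List A) → j ≤ length xs →
                   ∃[ ys ] ∃[ zs ] (ys ++ zs ≡ xs × length zs ≡ j)
  suffixOfLength j xs j≤ =
    take k xs , drop k xs , take++drop≡id k xs , trans (length-drop k xs) (m∸[m∸n]≡n j≤)
    where
    k : ℕ
    k = length xs ∸ j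

  splitAt< : ∀ j (xs : List A) → j < length xs →
             ∃[ ys ] ∃[ z ] ∃[ zs ] (ys ++ z ∷ zs ≡ xs × length ys ≡ j)
  splitAt< zero (x ∷ xs) _ = [] , x , xs , refl , refl
  splitAt< (suc j) (x ∷ xs) (s≤s j<) with splitAt< j xs j<
  ... | ys , z , zs , eq , len = x ∷ ys , z , zs , cong (x ∷_) eq , cong suc len

-- For a path, R = number of rotations,
-- T = number of Ω₁ vertices, s = number of Ω₂ vertices, ρ = number of reflections,
-- l = length of the leading block of reflections, E₂ and E₃ the numbers of times
-- the path enters Ω₂ resp. Ω₃.
module CensusArithmetic where

  m+m*[m∸1]≡m*m : ∀ m → m + m * (m ∸ 1) ≡ m * m
  m+m*[m∸1]≡m*m zero = refl
  m+m*[m∸1]≡m*m (suc k) = sym (*-suc (suc k) k)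

  -- the bound valid for every starting vertex
  censusBound : ∀ {m n R T ρ l E₃} → R ≤ n → T ≤ m → ρ ≤ l + m * E₃ → E₃ ≤ T →
                R + ρ ≤ n + (l + m * m)
  censusBound {m} {l = l} R≤n T≤m ρ≤ E₃≤T =
    +-mono-≤ R≤n (≤-trans ρ≤ (+-monoʳ-≤ l (*-monoʳ-≤ m (≤-trans E₃≤T T≤m))))

  -- the sharper bound when the path has to enter Ω₂ whenever it visits it
  sharpCensusBound : ∀ {m n R T s ρ l E₂ E₃} → R ≤ n → T ≤ m → R ≡ T + s →
                     ρ ≤ l + m * E₃ → E₂ + E₃ ≤ T → (0 < s → 0 < E₂) → 2 * m ≤ n →
                     R + ρ ≤ n + (l + m * (m ∸ 1))
  sharpCensusBound {m} {n} {R} {T} {zero} {ρ} {l} {E₂} {E₃} R≤n T≤m R≡T ρ≤ E≤T _ 2m≤n = begin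
    R + ρ                         ≤⟨ +-mono-≤ R≤m (≤-trans ρ≤ (+-monoʳ-≤ l (*-monoʳ-≤ m E₃≤m))) ⟩
    m + (l + m * m)               ≡⟨ cong (λ k → m + (l + k)) (sym (m+m*[m∸1]≡m*m m)) ⟩
    m + (l + (m + m * (m ∸ 1)))   ≡⟨ regroup m l (m * (m ∸ 1)) ⟩
    2 * m + (l + m * (m ∸ 1))     ≤⟨ +-monoˡ-≤ _ 2m≤n ⟩
    n + (l + m * (m ∸ 1))         ∎
    where
    open ≤-Reasoning
    R≤m : R ≤ m
    R≤m = ≤-trans (≤-reflexive (trans R≡T (+-identityʳ T))) T≤m
    E₃≤m : E₃ ≤ m
    E₃≤m = ≤-trans (m≤n+m E₃ E₂) (≤-trans E≤T T≤m)
    regroup : ∀ m l k → m + (l + (m + k)) ≡ 2 * m + (l + k)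
    regroup = solve-∀
  sharpCensusBound {m} {s = suc _} {l = l} {E₂} {E₃} R≤n T≤m _ ρ≤ E≤T enters 2m≤n =
    +-mono-≤ R≤n (≤-trans ρ≤ (+-monoʳ-≤ l (*-monoʳ-≤ m E₃≤m∸1)))
    where
    E₃≤m∸1 : E₃ ≤ m ∸ 1
    E₃≤m∸1 = ≤-trans (≤-reflexive (sym (m+n∸m≡n 1 E₃)))
               (∸-monoˡ-≤ 1 (≤-trans (+-monoˡ-≤ E₃ (enters z<s)) (≤-trans E≤T T≤m)))

module DetourEccentricity {n : ℕ} (_∙_ : Fin n → Fin n → Fin n) (e : Fin n) (_⁻¹ : Fin n → Fin n)
                          (isAbelian : IsAbelianGroup _≡_ _∙_ e _⁻¹) where

  open Dihedral _∙_ e _⁻¹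
  open IsAbelianGroup isAbelian using (assoc; comm; identityˡ; identityʳ; inverseˡ; inverseʳ)

  private
    G : AbelianGroup _ _
    G = record { isAbelianGroup = isAbelian }

  open GroupProperties (AbelianGroup.group G) using (∙-cancelˡ; ∙-cancelʳ; inverseˡ-unique)
  open CommutativeSemigroupProperties (AbelianGroup.commutativeSemigroup G) using (interchange)
  open CommutativeSemigroupProperties +-commutativeSemigroup using () renaming (interchange to +-interchange)
  open Removal (_≟_ {n})
  open Split
  open import Data.List.Membership.DecPropositional (_≟_ {n}) using (_∈?_)

  sq : Fin n → Fin n
  sq g = g ∙ g

  sq-∙ : ∀ g h → sq (g ∙ h) ≡ sq g ∙ sq h
  sq-∙ g h = interchange g h g h

  -- (g h⁻¹)(g h) = g², the identity behind the commutation rule for reflections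
  right-quotient-product : ∀ g h → (g ∙ (h ⁻¹)) ∙ (g ∙ h) ≡ sq g
  right-quotient-product g h = begin
    (g ∙ (h ⁻¹)) ∙ (g ∙ h)   ≡⟨ interchange g (h ⁻¹) g h ⟩
    sq g ∙ ((h ⁻¹) ∙ h)      ≡⟨ cong (sq g ∙_) (inverseˡ h) ⟩
    sq g ∙ e                 ≡⟨ identityʳ (sq g) ⟩
    sq g                     ∎
    where open ≡-Reasoning

  rot ref : Fin n → D
  rot g = g , true
  ref g = g , false

  Comm : D → D → Set
  Comm u v = u ⊙ v ≡ v ⊙ u

  rot-rot : ∀ g h → Comm (rot g) (rot h)
  rot-rot g h = cong (_, true) (comm g h)

  -- (g,1)(h,-1) = (gh,-1) and (h,-1)(g,1) = (hg⁻¹,-1): they commute iff g = g⁻¹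
  rot-ref⇒ : ∀ g h → Comm (rot g) (ref h) → sq g ≡ e
  rot-ref⇒ g h commutes = begin
    g ∙ g          ≡⟨ cong (g ∙_) (∙-cancelˡ h g (g ⁻¹) (trans (comm h g) (cong proj₁ commutes))) ⟩
    g ∙ (g ⁻¹)     ≡⟨ inverseʳ g ⟩
    e              ∎
    where open ≡-Reasoning

  rot-ref⇐ : ∀ g h → sq g ≡ e → Comm (rot g) (ref h)
  rot-ref⇐ g h g²≡e = cong (_, false) (trans (comm g h) (cong (h ∙_) (inverseˡ-unique g g g²≡e)))

  -- (g,-1)(h,-1) = (gh⁻¹,1): reflections commute iff their squares agree
  ref-ref⇒ : ∀ g h → Comm (ref g) (ref h) → sq g ≡ sq h
  ref-ref⇒ g h commutes = begin
    sq g                     ≡⟨ right-quotient-product g h ⟨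
    (g ∙ (h ⁻¹)) ∙ (g ∙ h)   ≡⟨ cong₂ _∙_ (cong proj₁ commutes) (comm g h) ⟩
    (h ∙ (g ⁻¹)) ∙ (h ∙ g)   ≡⟨ right-quotient-product h g ⟩
    sq h                     ∎
    where open ≡-Reasoning

  ref-ref⇐ : ∀ g h → sq g ≡ sq h → Comm (ref g) (ref h)
  ref-ref⇐ g h g²≡h² = cong (_, true) (∙-cancelʳ (g ∙ h) _ _ (begin
    (g ∙ (h ⁻¹)) ∙ (g ∙ h)   ≡⟨ right-quotient-product g h ⟩
    sq g                     ≡⟨ g²≡h² ⟩
    sq h                     ≡⟨ right-quotient-product h g ⟨
    (h ∙ (g ⁻¹)) ∙ (h ∙ g)   ≡⟨ cong ((h ∙ (g ⁻¹)) ∙_) (comm h g) ⟩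
    (h ∙ (g ⁻¹)) ∙ (g ∙ h)   ∎))
    where open ≡-Reasoning

  central : ∀ {w} → sq w ≡ e → ∀ x → Comm (rot w) x
  central {w} w²≡e (h , true) = rot-rot w h
  central {w} w²≡e (h , false) = rot-ref⇐ w h w²≡e

  allSquaresTrivial⇒abelian : (∀ g → sq g ≡ e) → ∀ u v → Comm u v
  allSquaresTrivial⇒abelian all (g , true) v = central (all g) v
  allSquaresTrivial⇒abelian all (g , false) (h , true) = sym (central (all h) (ref g))
  allSquaresTrivial⇒abelian all (g , false) (h , false) = ref-ref⇐ g h (trans (all g) (sym (all h)))

  -- The subgroup K = {g : g² = e} and its cosets ("classes")

  involutions others : List (Fin n)
  involutions = filter (λ g → sq g ≟ e) (allFin n)
  others = filter (λ g → ¬? (sq g ≟ e)) (allFin n)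

  m : ℕ
  m = length involutions

  ∈-involutions⁺ : ∀ {g} → sq g ≡ e → g ∈ involutions
  ∈-involutions⁺ {g} = ∈-filter⁺ (λ g → sq g ≟ e) (∈-allFin g)

  ∈-involutions⁻ : ∀ {g} → g ∈ involutions → sq g ≡ e
  ∈-involutions⁻ g∈ = proj₂ (∈-filter⁻ (λ g → sq g ≟ e) {xs = allFin n} g∈)

  ∈-others⁻ : ∀ {g} → g ∈ others → sq g ≢ e
  ∈-others⁻ g∈ = proj₂ (∈-filter⁻ (λ g → ¬? (sq g ≟ e)) {xs = allFin n} g∈)

  unique-involutions : Unique involutions
  unique-involutions = Unique.filter⁺ (λ g → sq g ≟ e) (Unique.allFin⁺ n)

  unique-others : Unique others
  unique-others = Unique.filter⁺ (λ g → ¬? (sq g ≟ e)) (Unique.allFin⁺ n)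

  length-allFin : length (allFin n) ≡ n
  length-allFin = length-tabulate (λ i → i)

  unique⇒length≤n : ∀ {gs} → Unique gs → length gs ≤ n
  unique⇒length≤n u = ≤-trans (unique⊆⇒length≤ u (λ {g} _ → ∈-allFin g)) (≤-reflexive length-allFin)

  K-others-disjoint : ∀ {g} → g ∈ involutions → g ∉ others
  K-others-disjoint g∈K g∈others = ∈-others⁻ g∈others (∈-involutions⁻ g∈K)

  m+others≡n : m + length others ≡ n
  m+others≡n = trans (partition (allFin n)) length-allFin
    where
    partition : ∀ gs → length (filter (λ g → sq g ≟ e) gs) + length (filter (λ g → ¬? (sq g ≟ e)) gs)
                       ≡ length gs
    partition [] = refl
    partition (g ∷ gs) with sq g ≟ e
    ... | yes _ = cong suc (partition gs)
    ... | no _ = trans (+-suc _ _) (cong suc (partition gs))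

  unique-K++others : Unique (involutions ++ others)
  unique-K++others = Unique.++⁺ unique-involutions unique-others (λ (g∈K , g∈o) → K-others-disjoint g∈K g∈o)

  length-K++others : length (involutions ++ others) ≡ n
  length-K++others = trans (length-++ involutions) m+others≡n

  unique-others++K : Unique (others ++ involutions)
  unique-others++K = Unique.++⁺ unique-others unique-involutions (λ (g∈o , g∈K) → K-others-disjoint g∈K g∈o)

  length-others++K : length (others ++ involutions) ≡ n
  length-others++K = trans (length-++ others) (trans (+-comm (length others) m) m+others≡n)

  ∈-others++K : ∀ g → g ∈ others ++ involutions
  ∈-others++K g with sq g ≟ e
  ... | yes g²≡e = ∈-++⁺ʳ others (∈-involutions⁺ g²≡e)
  ... | no g²≢e = ∈-++⁺ˡ (∈-filter⁺ (λ g → ¬? (sq g ≟ e)) (∈-allFin g) g²≢e)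

  0<m : 0 < m
  0<m = unique⊆⇒length≤ {xs = e ∷ []} ([] ∷ []) λ { (here refl) → ∈-involutions⁺ (identityʳ e) }

  -- the class of g: all h with h² = g², listed as K g
  class : Fin n → List (Fin n)
  class g = map (_∙ g) involutions

  length-class : ∀ g → length (class g) ≡ m
  length-class g = length-map (_∙ g) involutions

  unique-class : ∀ g → Unique (class g)
  unique-class g = Unique.map⁺ (∙-cancelʳ g _ _) unique-involutions

  ∈-class⁻ : ∀ g {h} → h ∈ class g → sq h ≡ sq g
  ∈-class⁻ g h∈ with ∈-map⁻ (_∙ g) h∈
  ... | k , k∈K , refl = begin
    sq (k ∙ g)     ≡⟨ sq-∙ k g ⟩
    sq k ∙ sq g    ≡⟨ cong (_∙ sq g) (∈-involutions⁻ k∈K) ⟩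
    e ∙ sq g       ≡⟨ identityˡ (sq g) ⟩
    sq g           ∎
    where open ≡-Reasoning

  ∈-class⁺ : ∀ g {h} → sq h ≡ sq g → h ∈ class g
  ∈-class⁺ g {h} h²≡g² = subst (_∈ class g) h/g∙g≡h (∈-map⁺ (_∙ g) (∈-involutions⁺ h/g-involution))
    where
    open ≡-Reasoning
    h/g-involution : sq (h ∙ (g ⁻¹)) ≡ e
    h/g-involution = begin
      sq (h ∙ (g ⁻¹))        ≡⟨ sq-∙ h (g ⁻¹) ⟩
      sq h ∙ sq (g ⁻¹)       ≡⟨ cong (_∙ sq (g ⁻¹)) h²≡g² ⟩
      sq g ∙ sq (g ⁻¹)       ≡⟨ sq-∙ g (g ⁻¹) ⟨
      sq (g ∙ (g ⁻¹))        ≡⟨ cong sq (inverseʳ g) ⟩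
      sq e                   ≡⟨ identityʳ e ⟩
      e                      ∎
    h/g∙g≡h : (h ∙ (g ⁻¹)) ∙ g ≡ h
    h/g∙g≡h = begin
      (h ∙ (g ⁻¹)) ∙ g       ≡⟨ assoc h (g ⁻¹) g ⟩
      h ∙ ((g ⁻¹) ∙ g)       ≡⟨ cong (h ∙_) (inverseˡ g) ⟩
      h ∙ e                  ≡⟨ identityʳ h ⟩
      h                      ∎

  -- Paths as vertex lists: a path from u is a list u ∷ xs without repetitions in
  -- which consecutive vertices commute.

  IsPathList : List D → Set
  IsPathList xs = Linked Comm xs × Unique xs

  walk-linked : ∀ {u v} (p : Walk u v) → Linked Comm (verts p)
  walk-linked stop = [-]
  walk-linked (step (_ , c) stop) = c ∷ [-]
  walk-linked (step (_ , c) (step a p)) = c ∷ walk-linked (step a p)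

  walk-length : ∀ {u v} (p : Walk u v) → length (verts p) ≡ suc (len p)
  walk-length stop = refl
  walk-length (step _ p) = cong suc (walk-length p)

  walk-start : ∀ {u v} (p : Walk u v) → ∃[ xs ] (verts p ≡ u ∷ xs)
  walk-start stop = _ , refl
  walk-start (step _ p) = _ , refl

  list⇒walk : ∀ u xs → IsPathList (u ∷ xs) → ∃[ v ] Σ (Walk u v) (λ p → verts p ≡ u ∷ xs)
  list⇒walk u [] _ = u , stop , refl
  list⇒walk u (y ∷ ys) (c ∷ linked , (u∉ ∷ ys!)) with list⇒walk y ys (linked , ys!)
  ... | v , p , verts≡ = v , step (All.lookup u∉ (here refl) , c) p , cong (u ∷_) verts≡

  PathFrom : D → ℕ → Set
  PathFrom u k = ∃[ xs ] (IsPathList (u ∷ xs) × length (u ∷ xs) ≡ k)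

  PathsBounded : D → ℕ → Set
  PathsBounded u k = ∀ xs → IsPathList (u ∷ xs) → length (u ∷ xs) ≤ k

  detourEcc : ∀ u k → PathsBounded u k → PathFrom u k → IsDetourEcc u (k ∸ 1)
  detourEcc u k bounded (xs , isPath , len≡k) with list⇒walk u xs isPath
  ... | v , p , verts≡ =
    (v , (p , p-path , p-length) , longest) ,
    λ _ _ ((q , q-path , q≡) , _) → subst (_≤ k ∸ 1) q≡ (longest q q-path)
    where
    p-path : IsPath p
    p-path = subst Unique (sym verts≡) (proj₂ isPath)
    p-length : len p ≡ k ∸ 1
    p-length = cong (_∸ 1) (trans (sym (walk-length p)) (trans (cong length verts≡) len≡k))
    longest : ∀ {w} (q : Walk u w) → IsPath q → len q ≤ k ∸ 1
    longest q q-path with walk-start q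
    ... | ys , verts≡ = ∸-monoˡ-≤ 1 (subst (_≤ k) (trans (cong length (sym verts≡)) (walk-length q))
                          (bounded ys (subst (Linked Comm) verts≡ (walk-linked q) , subst Unique verts≡ q-path)))

  rots refs : List D → List (Fin n)
  rots [] = []
  rots ((g , true) ∷ xs) = g ∷ rots xs
  rots ((g , false) ∷ xs) = rots xs
  refs [] = []
  refs ((g , true) ∷ xs) = refs xs
  refs ((g , false) ∷ xs) = g ∷ refs xs

  length-rots-refs : ∀ xs → length xs ≡ length (rots xs) + length (refs xs)
  length-rots-refs [] = refl
  length-rots-refs ((g , true) ∷ xs) = cong suc (length-rots-refs xs)
  length-rots-refs ((g , false) ∷ xs) = trans (cong suc (length-rots-refs xs)) (sym (+-suc _ _))

  ∈-rots : ∀ {g} xs → g ∈ rots xs → rot g ∈ xs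
  ∈-rots ((h , true) ∷ xs) (here refl) = here refl
  ∈-rots ((h , true) ∷ xs) (there g∈) = there (∈-rots xs g∈)
  ∈-rots ((h , false) ∷ xs) g∈ = there (∈-rots xs g∈)

  ∈-refs : ∀ {g} xs → g ∈ refs xs → ref g ∈ xs
  ∈-refs ((h , false) ∷ xs) (here refl) = here refl
  ∈-refs ((h , false) ∷ xs) (there g∈) = there (∈-refs xs g∈)
  ∈-refs ((h , true) ∷ xs) g∈ = there (∈-refs xs g∈)

  rots-∈ : ∀ {g} xs → rot g ∈ xs → g ∈ rots xs
  rots-∈ ((h , true) ∷ xs) (here refl) = here refl
  rots-∈ ((h , true) ∷ xs) (there g∈) = there (rots-∈ xs g∈)
  rots-∈ ((h , false) ∷ xs) (there g∈) = rots-∈ xs g∈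

  refs-∈ : ∀ {g} xs → ref g ∈ xs → g ∈ refs xs
  refs-∈ ((h , false) ∷ xs) (here refl) = here refl
  refs-∈ ((h , false) ∷ xs) (there g∈) = there (refs-∈ xs g∈)
  refs-∈ ((h , true) ∷ xs) (there g∈) = refs-∈ xs g∈

  unique-rots : ∀ {xs} → Unique xs → Unique (rots xs)
  unique-rots {[]} [] = []
  unique-rots {(g , true) ∷ xs} (x∉ ∷ xs!) =
    All.tabulate (λ h∈ g≡h → All.lookup x∉ (∈-rots xs h∈) (cong rot g≡h)) ∷ unique-rots xs!
  unique-rots {(g , false) ∷ xs} (_ ∷ xs!) = unique-rots xs!

  unique-refs : ∀ {xs} → Unique xs → Unique (refs xs)
  unique-refs {[]} [] = []
  unique-refs {(g , false) ∷ xs} (x∉ ∷ xs!) =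
    All.tabulate (λ h∈ g≡h → All.lookup x∉ (∈-refs xs h∈) (cong ref g≡h)) ∷ unique-refs xs!
  unique-refs {(g , true) ∷ xs} (_ ∷ xs!) = unique-refs xs!

  unique-from-parts : ∀ xs → Unique (rots xs) → Unique (refs xs) → Unique xs
  unique-from-parts [] _ _ = []
  unique-from-parts ((g , true) ∷ xs) (g∉ ∷ rots!) refs! =
    All.tabulate (λ { y∈ refl → All.lookup g∉ (rots-∈ xs y∈) refl }) ∷ unique-from-parts xs rots! refs!
  unique-from-parts ((g , false) ∷ xs) rots! (g∉ ∷ refs!) =
    All.tabulate (λ { y∈ refl → All.lookup g∉ (refs-∈ xs y∈) refl }) ∷ unique-from-parts xs rots! refs!

  unique⇒length≤2n : ∀ {xs} → Unique xs → length xs ≤ 2 * n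
  unique⇒length≤2n {xs} xs! = begin
    length xs                            ≡⟨ length-rots-refs xs ⟩
    length (rots xs) + length (refs xs)  ≤⟨ +-mono-≤ (unique⇒length≤n (unique-rots xs!))
                                                     (unique⇒length≤n (unique-refs xs!)) ⟩
    n + n                                ≡⟨ cong (n +_) (sym (+-identityʳ n)) ⟩
    2 * n                                ∎
    where open ≤-Reasoning

  data Kind : Set where
    Ω₁ Ω₂ Ω₃ : Kind

  kind : D → Kind
  kind (g , true) = if does (sq g ≟ e) then Ω₁ else Ω₂
  kind (g , false) = Ω₃

  kind-central : ∀ {g} → sq g ≡ e → kind (rot g) ≡ Ω₁
  kind-central {g} g²≡e with sq g ≟ e
  ... | yes _ = refl
  ... | no g²≢e = contradiction g²≡e g²≢e

  kind-noncentral : ∀ {g} → sq g ≢ e → kind (rot g) ≡ Ω₂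
  kind-noncentral {g} g²≢e with sq g ≟ e
  ... | yes g²≡e = contradiction g²≡e g²≢e
  ... | no _ = refl

  kind≡Ω₂ : ∀ x → kind x ≡ Ω₂ → ∃[ g ] (x ≡ rot g × sq g ≢ e)
  kind≡Ω₂ (g , true) _ with sq g ≟ e
  kind≡Ω₂ (g , true) () | yes _
  ... | no g²≢e = g , refl , g²≢e

  kind≡Ω₃ : ∀ x → kind x ≡ Ω₃ → ∃[ g ] (x ≡ ref g)
  kind≡Ω₃ (g , false) _ = g , refl
  kind≡Ω₃ (g , true) _ with sq g ≟ e
  kind≡Ω₃ (g , true) () | yes _
  kind≡Ω₃ (g , true) () | no _

  δ : Kind → Kind → ℕ
  δ Ω₁ Ω₁ = 1
  δ Ω₂ Ω₂ = 1
  δ Ω₃ Ω₃ = 1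
  δ _ _ = 0

  count : Kind → List D → ℕ
  count k [] = 0
  count k (x ∷ xs) = δ (kind x) k + count k xs

  -- number of steps entering kind k from another kind, after a vertex of kind a
  entriesAfter : Kind → Kind → List D → ℕ
  entriesAfter k a [] = 0
  entriesAfter k a (y ∷ ys) = (δ (kind y) k ∸ δ a k) + entriesAfter k (kind y) ys

  entries : Kind → List D → ℕ
  entries k [] = 0
  entries k (x ∷ xs) = entriesAfter k (kind x) xs

  -- number of reflections at the start of a list
  leadStep : Kind → ℕ → ℕ
  leadStep Ω₃ l = suc l
  leadStep _ _ = 0

  lead : List D → ℕ
  lead [] = 0
  lead (x ∷ xs) = leadStep (kind x) (lead xs)

  length-rots : ∀ xs → length (rots xs) ≡ count Ω₁ xs + count Ω₂ xs
  length-rots [] = refl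
  length-rots ((g , false) ∷ xs) = length-rots xs
  length-rots ((g , true) ∷ xs) with sq g ≟ e
  ... | yes _ = cong suc (length-rots xs)
  ... | no _ = trans (cong suc (length-rots xs)) (sym (+-suc _ _))

  length-refs : ∀ xs → length (refs xs) ≡ count Ω₃ xs
  length-refs [] = refl
  length-refs ((g , false) ∷ xs) = cong suc (length-refs xs)
  length-refs ((g , true) ∷ xs) with sq g ≟ e
  ... | yes _ = length-refs xs
  ... | no _ = length-refs xs

  count-central : ∀ xs → count Ω₁ xs ≡ length (filter (λ g → sq g ≟ e) (rots xs))
  count-central [] = refl
  count-central ((g , false) ∷ xs) = count-central xs
  count-central ((g , true) ∷ xs) with sq g ≟ e
  ... | yes _ = cong suc (count-central xs)
  ... | no _ = count-central xs

  central-bound : ∀ {xs} → Unique xs → count Ω₁ xs ≤ m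
  central-bound {xs} xs! = subst (_≤ m) (sym (count-central xs))
    (unique⊆⇒length≤ (Unique.filter⁺ (λ g → sq g ≟ e) (unique-rots xs!))
      (λ g∈ → ∈-involutions⁺ (proj₂ (∈-filter⁻ (λ g → sq g ≟ e) {xs = rots xs} g∈))))

  -- Ω₂ and Ω₃ are never adjacent, so every entry into Ω₂ or Ω₃ comes from Ω₁
  Ω₂-Ω₃-apart : ∀ {x y} → Comm x y → kind x ≡ Ω₂ → kind y ≡ Ω₃ → ⊥
  Ω₂-Ω₃-apart {x} {y} commutes x∈Ω₂ y∈Ω₃ with kind≡Ω₂ x x∈Ω₂ | kind≡Ω₃ y y∈Ω₃
  ... | g , refl , g²≢e | h , refl = g²≢e (rot-ref⇒ g h commutes)

  Adjacent : Kind → Kind → Set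
  Adjacent a b = ¬ (a ≡ Ω₂ × b ≡ Ω₃) × ¬ (a ≡ Ω₃ × b ≡ Ω₂)

  comm⇒adjacent : ∀ {x y} → Comm x y → Adjacent (kind x) (kind y)
  comm⇒adjacent {x} {y} c = (λ (x∈Ω₂ , y∈Ω₃) → Ω₂-Ω₃-apart {x} {y} c x∈Ω₂ y∈Ω₃) ,
                            (λ (x∈Ω₃ , y∈Ω₂) → Ω₂-Ω₃-apart {y} {x} (sym c) y∈Ω₂ x∈Ω₃)

  entryStep : ∀ a b → Adjacent a b → (δ b Ω₂ ∸ δ a Ω₂) + (δ b Ω₃ ∸ δ a Ω₃) ≤ δ a Ω₁
  entryStep Ω₁ Ω₁ _ = z≤n
  entryStep Ω₁ Ω₂ _ = s≤s z≤n
  entryStep Ω₁ Ω₃ _ = s≤s z≤n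
  entryStep Ω₂ Ω₁ _ = z≤n
  entryStep Ω₂ Ω₂ _ = z≤n
  entryStep Ω₂ Ω₃ (apart , _) = contradiction (refl , refl) apart
  entryStep Ω₃ Ω₁ _ = z≤n
  entryStep Ω₃ Ω₂ (_ , apart) = contradiction (refl , refl) apart
  entryStep Ω₃ Ω₃ _ = z≤n

  entries-bound : ∀ {xs} → Linked Comm xs → entries Ω₂ xs + entries Ω₃ xs ≤ count Ω₁ xs
  entries-bound {[]} _ = z≤n
  entries-bound {x ∷ []} _ = z≤n
  entries-bound {x ∷ y ∷ ys} (c ∷ linked) =
    subst (_≤ count Ω₁ (x ∷ y ∷ ys))
          (+-interchange (δ (kind y) Ω₂ ∸ δ (kind x) Ω₂) (δ (kind y) Ω₃ ∸ δ (kind x) Ω₃) _ _)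
      (+-mono-≤ (entryStep (kind x) (kind y) (comm⇒adjacent {x} {y} c)) (entries-bound linked))

  δ[a,Ω₂]≡0 : ∀ a → a ≢ Ω₂ → δ a Ω₂ ≡ 0
  δ[a,Ω₂]≡0 Ω₁ _ = refl
  δ[a,Ω₂]≡0 Ω₂ a∉Ω₂ = contradiction refl a∉Ω₂
  δ[a,Ω₂]≡0 Ω₃ _ = refl

  entersΩ₂ : ∀ a ys → a ≢ Ω₂ → 0 < count Ω₂ ys → 0 < entriesAfter Ω₂ a ys
  entersΩ₂ a (y ∷ ys) a∉Ω₂ visits with kind y
  ... | Ω₁ = ≤-trans (entersΩ₂ Ω₁ ys (λ ()) visits) (m≤n+m _ _)
  ... | Ω₃ = ≤-trans (entersΩ₂ Ω₃ ys (λ ()) visits) (m≤n+m _ _)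
  ... | Ω₂ = ≤-trans (≤-reflexive (cong (1 ∸_) (sym (δ[a,Ω₂]≡0 a a∉Ω₂)))) (m≤m+n _ _)

  -- the leading block of reflections of a path lies in one class, so has ≤ m vertices
  leadingRun : List D → List (Fin n)
  leadingRun ((g , false) ∷ xs) = g ∷ leadingRun xs
  leadingRun _ = []

  lead≡length-leadingRun : ∀ xs → lead xs ≡ length (leadingRun xs)
  lead≡length-leadingRun [] = refl
  lead≡length-leadingRun ((g , false) ∷ xs) = cong suc (lead≡length-leadingRun xs)
  lead≡length-leadingRun ((g , true) ∷ xs) with sq g ≟ e
  ... | yes _ = refl
  ... | no _ = refl

  leadingRun-⊆-refs : ∀ xs → leadingRun xs ⊆ refs xs
  leadingRun-⊆-refs ((g , false) ∷ xs) (here refl) = here refl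
  leadingRun-⊆-refs ((g , false) ∷ xs) (there h∈) = there (leadingRun-⊆-refs xs h∈)

  unique-leadingRun : ∀ {xs} → Unique xs → Unique (leadingRun xs)
  unique-leadingRun {[]} _ = []
  unique-leadingRun {(g , true) ∷ xs} _ = []
  unique-leadingRun {(g , false) ∷ xs} (x∉ ∷ xs!) =
    All.tabulate (λ h∈ g≡h → All.lookup x∉ (∈-refs xs (leadingRun-⊆-refs xs h∈)) (cong ref g≡h))
    ∷ unique-leadingRun xs!

  leadingRun-squares : ∀ g xs → Linked Comm (ref g ∷ xs) → All (λ h → sq h ≡ sq g) (leadingRun (ref g ∷ xs))
  leadingRun-squares g [] _ = refl ∷ []
  leadingRun-squares g ((h , true) ∷ ys) _ = refl ∷ []
  leadingRun-squares g ((h , false) ∷ ys) (c ∷ linked) =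
    refl ∷ All.map (λ eq → trans eq (sym (ref-ref⇒ g h c))) (leadingRun-squares h ys linked)

  lead-bound : ∀ {xs} → IsPathList xs → lead xs ≤ m
  lead-bound {[]} _ = z≤n
  lead-bound {(g , true) ∷ xs} _ = subst (_≤ m) (sym (lead≡length-leadingRun (rot g ∷ xs))) z≤n
  lead-bound {(g , false) ∷ xs} (linked , xs!) = begin
    lead (ref g ∷ xs)                  ≡⟨ lead≡length-leadingRun (ref g ∷ xs) ⟩
    length (leadingRun (ref g ∷ xs))  ≤⟨ unique⊆⇒length≤ (unique-leadingRun xs!) ⊆class ⟩
    length (class g)                   ≡⟨ length-class g ⟩
    m                                  ∎
    where
    open ≤-Reasoning
    ⊆class : leadingRun (ref g ∷ xs) ⊆ class g
    ⊆class h∈ = ∈-class⁺ g (All.lookup (leadingRun-squares g xs linked) h∈)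

  -- every block of reflections other than the leading one is entered from outside Ω₃
  -- and has at most m vertices; entering a block costs at most m
  newBlock : ∀ {l} E → l ≤ m → l + m * E ≤ m * suc E
  newBlock E l≤m = ≤-trans (+-monoˡ-≤ (m * E) l≤m) (≤-reflexive (sym (*-suc m E)))

  runStep : ∀ a b l ρ E → leadStep b l ≤ m → ρ ≤ leadStep b l + m * E →
            δ a Ω₃ + ρ ≤ leadStep a (leadStep b l) + m * ((δ b Ω₃ ∸ δ a Ω₃) + E)
  runStep Ω₃ Ω₃ _ _ _ _ ρ≤ = s≤s ρ≤
  runStep Ω₃ Ω₁ _ _ _ _ ρ≤ = s≤s ρ≤
  runStep Ω₃ Ω₂ _ _ _ _ ρ≤ = s≤s ρ≤
  runStep Ω₁ Ω₁ _ _ _ _ ρ≤ = ρ≤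
  runStep Ω₁ Ω₂ _ _ _ _ ρ≤ = ρ≤
  runStep Ω₂ Ω₁ _ _ _ _ ρ≤ = ρ≤
  runStep Ω₂ Ω₂ _ _ _ _ ρ≤ = ρ≤
  runStep Ω₁ Ω₃ _ _ E block≤m ρ≤ = ≤-trans ρ≤ (newBlock E block≤m)
  runStep Ω₂ Ω₃ _ _ E block≤m ρ≤ = ≤-trans ρ≤ (newBlock E block≤m)

  reflections-bound : ∀ {xs} → IsPathList xs → count Ω₃ xs ≤ lead xs + m * entries Ω₃ xs
  reflections-bound {[]} _ = z≤n
  reflections-bound {x ∷ []} _ = single (kind x)
    where
    single : ∀ a → δ a Ω₃ + 0 ≤ leadStep a 0 + m * 0
    single Ω₁ = z≤n
    single Ω₂ = z≤n
    single Ω₃ = s≤s z≤n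
  reflections-bound {x ∷ y ∷ ys} (c ∷ linked , _ ∷ ys!) =
    runStep (kind x) (kind y) (lead ys) _ _ (lead-bound (linked , ys!)) (reflections-bound (linked , ys!))

  -- Upper bounds on the number of vertices of a path

  open CensusArithmetic

  pathBound : ∀ {xs} → IsPathList xs → length xs ≤ n + (lead xs + m * m)
  pathBound {xs} path@(linked , xs!) = subst (_≤ n + (lead xs + m * m)) (sym (length-rots-refs xs))
    (censusBound (unique⇒length≤n (unique-rots xs!)) (central-bound xs!)
      (subst (_≤ lead xs + m * entries Ω₃ xs) (sym (length-refs xs)) (reflections-bound path))
      (≤-trans (m≤n+m _ (entries Ω₂ xs)) (entries-bound linked)))

  sharpPathBound : ∀ u xs → IsPathList (u ∷ xs) → kind u ≢ Ω₂ → 2 * m ≤ n →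
                   length (u ∷ xs) ≤ n + (lead (u ∷ xs) + m * (m ∸ 1))
  sharpPathBound u xs path@(linked , xs!) u∉Ω₂ 2m≤n =
    subst (_≤ n + (lead (u ∷ xs) + m * (m ∸ 1))) (sym (length-rots-refs (u ∷ xs)))
    (sharpCensusBound (unique⇒length≤n (unique-rots xs!)) (central-bound xs!) (length-rots (u ∷ xs))
      (subst (_≤ lead (u ∷ xs) + m * entries Ω₃ (u ∷ xs)) (sym (length-refs (u ∷ xs))) (reflections-bound path))
      (entries-bound linked)
      visits⇒enters 2m≤n)
    where
    visits⇒enters : 0 < count Ω₂ (u ∷ xs) → 0 < entries Ω₂ (u ∷ xs)
    visits⇒enters visits =
      entersΩ₂ (kind u) xs u∉Ω₂ (subst (λ d → 0 < d + count Ω₂ xs) (δ[a,Ω₂]≡0 (kind u) u∉Ω₂) visits)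

  trivialBound : ∀ u → PathsBounded u (2 * n)
  trivialBound u xs (_ , xs!) = unique⇒length≤2n xs!

  centralBound : ∀ {g} → sq g ≡ e → 2 * m ≤ n → PathsBounded (rot g) (n + m * (m ∸ 1))
  centralBound {g} g²≡e 2m≤n xs path =
    subst (λ a → length (rot g ∷ xs) ≤ n + (leadStep a (lead xs) + m * (m ∸ 1))) (kind-central g²≡e)
      (sharpPathBound (rot g) xs path (λ g∈Ω₂ → Ω₁≢Ω₂ (trans (sym (kind-central g²≡e)) g∈Ω₂)) 2m≤n)
    where
    Ω₁≢Ω₂ : Ω₁ ≢ Ω₂
    Ω₁≢Ω₂ ()

  noncentralBound : ∀ {g} → sq g ≢ e → PathsBounded (rot g) (n + m * m)
  noncentralBound {g} g²≢e xs path =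
    subst (λ a → length (rot g ∷ xs) ≤ n + (leadStep a (lead xs) + m * m)) (kind-noncentral g²≢e)
      (pathBound path)

  reflectionBound : ∀ g → 2 * m ≤ n → PathsBounded (ref g) (n + m * m)
  reflectionBound g 2m≤n xs path = begin
    length (ref g ∷ xs)                          ≤⟨ sharpPathBound (ref g) xs path (λ ()) 2m≤n ⟩
    n + (lead (ref g ∷ xs) + m * (m ∸ 1))        ≤⟨ +-monoʳ-≤ n (+-monoˡ-≤ (m * (m ∸ 1)) (lead-bound path)) ⟩
    n + (m + m * (m ∸ 1))                        ≡⟨ cong (n +_) (m+m*[m∸1]≡m*m m) ⟩
    n + m * m                                    ∎
    where open ≤-Reasoning

  -- Lower bounds: long paths through whole classes

  -- a list of elements with distinct squares names distinct classes
  Distinct : List (Fin n) → Set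
  Distinct gs = Unique (map sq gs)

  classesOf : List (Fin n) → List (Fin n)
  classesOf [] = []
  classesOf (g ∷ gs) = class g ++ classesOf gs

  length-classesOf : ∀ gs → length (classesOf gs) ≡ length gs * m
  length-classesOf [] = refl
  length-classesOf (g ∷ gs) = trans (length-++ (class g)) (cong₂ _+_ (length-class g) (length-classesOf gs))

  ∈-classesOf⁻ : ∀ gs {h} → h ∈ classesOf gs → sq h ∈ map sq gs
  ∈-classesOf⁻ (g ∷ gs) h∈ with ∈-++⁻ (class g) h∈
  ... | inj₁ h∈class = here (∈-class⁻ g h∈class)
  ... | inj₂ h∈rest = there (∈-classesOf⁻ gs h∈rest)

  ∈-classesOf⁺ : ∀ gs {h} → sq h ∈ map sq gs → h ∈ classesOf gs
  ∈-classesOf⁺ (g ∷ gs) (here h²≡g²) = ∈-++⁺ˡ (∈-class⁺ g h²≡g²)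
  ∈-classesOf⁺ (g ∷ gs) (there h²∈) = ∈-++⁺ʳ (class g) (∈-classesOf⁺ gs h²∈)

  unique-classesOf : ∀ gs → Distinct gs → Unique (classesOf gs)
  unique-classesOf [] _ = []
  unique-classesOf (g ∷ gs) (g²∉ ∷ gs!) =
    Unique.++⁺ (unique-class g) (unique-classesOf gs gs!)
      (λ (h∈class , h∈rest) → All.lookup g²∉ (∈-classesOf⁻ gs h∈rest) (sym (∈-class⁻ g h∈class)))

  block : Fin n → List D
  block g = map ref (class g)

  pairs : List (Fin n) → List (Fin n) → List D
  pairs (w ∷ ws) (g ∷ gs) = rot w ∷ (block g ++ pairs ws gs)
  pairs _ _ = []

  rots-++ : ∀ xs ys → rots (xs ++ ys) ≡ rots xs ++ rots ys
  rots-++ [] ys = refl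
  rots-++ ((g , true) ∷ xs) ys = cong (g ∷_) (rots-++ xs ys)
  rots-++ ((g , false) ∷ xs) ys = rots-++ xs ys

  refs-++ : ∀ xs ys → refs (xs ++ ys) ≡ refs xs ++ refs ys
  refs-++ [] ys = refl
  refs-++ ((g , true) ∷ xs) ys = refs-++ xs ys
  refs-++ ((g , false) ∷ xs) ys = cong (g ∷_) (refs-++ xs ys)

  rots-rot : ∀ gs → rots (map rot gs) ≡ gs
  rots-rot [] = refl
  rots-rot (g ∷ gs) = cong (g ∷_) (rots-rot gs)

  refs-rot : ∀ gs → refs (map rot gs) ≡ []
  refs-rot [] = refl
  refs-rot (g ∷ gs) = refs-rot gs

  rots-ref : ∀ gs → rots (map ref gs) ≡ []
  rots-ref [] = refl
  rots-ref (g ∷ gs) = rots-ref gs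

  refs-ref : ∀ gs → refs (map ref gs) ≡ gs
  refs-ref [] = refl
  refs-ref (g ∷ gs) = cong (g ∷_) (refs-ref gs)

  rots-pairs : ∀ ws gs → length ws ≡ length gs → rots (pairs ws gs) ≡ ws
  rots-pairs [] [] _ = refl
  rots-pairs (w ∷ ws) (g ∷ gs) ws≡gs = cong (w ∷_) (begin
    rots (block g ++ pairs ws gs)          ≡⟨ rots-++ (block g) (pairs ws gs) ⟩
    rots (block g) ++ rots (pairs ws gs)   ≡⟨ cong₂ _++_ (rots-ref (class g)) (rots-pairs ws gs (suc-injective ws≡gs)) ⟩
    ws                                     ∎)
    where open ≡-Reasoning

  refs-pairs : ∀ ws gs → length ws ≡ length gs → refs (pairs ws gs) ≡ classesOf gs
  refs-pairs [] [] _ = refl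
  refs-pairs (w ∷ ws) (g ∷ gs) ws≡gs = begin
    refs (block g ++ pairs ws gs)          ≡⟨ refs-++ (block g) (pairs ws gs) ⟩
    refs (block g) ++ refs (pairs ws gs)   ≡⟨ cong₂ _++_ (refs-ref (class g)) (refs-pairs ws gs (suc-injective ws≡gs)) ⟩
    class g ++ classesOf gs                ∎
    where open ≡-Reasoning

  rotations-linked : ∀ gs → Linked Comm (map rot gs)
  rotations-linked [] = []
  rotations-linked (g ∷ []) = [-]
  rotations-linked (g ∷ h ∷ gs) = rot-rot g h ∷ rotations-linked (h ∷ gs)

  sameSquare-linked : ∀ {c} gs → All (λ h → sq h ≡ c) gs → Linked Comm (map ref gs)
  sameSquare-linked [] _ = []
  sameSquare-linked (g ∷ []) _ = [-]
  sameSquare-linked (g ∷ h ∷ gs) (g² ∷ h² ∷ rest) =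
    ref-ref⇐ g h (trans g² (sym h²)) ∷ sameSquare-linked (h ∷ gs) (h² ∷ rest)

  CentralHead : Maybe D → Set
  CentralHead nothing = ⊤
  CentralHead (just y) = ∃[ w ] (y ≡ rot w × sq w ≡ e)

  connect-to-central : ∀ {my} → CentralHead my → ∀ mx → Connected Comm mx my
  connect-to-central {nothing} _ (just x) = just-nothing
  connect-to-central {nothing} _ nothing = nothing
  connect-to-central {just y} _ nothing = nothing-just
  connect-to-central {just _} (w , refl , w²≡e) (just x) = just (sym (central w²≡e x))

  connect-from-central : ∀ {w} → sq w ≡ e → ∀ my → Connected Comm (just (rot w)) my
  connect-from-central w²≡e nothing = just-nothing
  connect-from-central w²≡e (just y) = just (central w²≡e y)

  head-++ : ∀ xs ys → CentralHead (head xs) → CentralHead (head ys) → CentralHead (head (xs ++ ys))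
  head-++ [] ys _ ys-head = ys-head
  head-++ (x ∷ xs) ys xs-head _ = xs-head

  pairs-head : ∀ {ws} gs → All (λ w → sq w ≡ e) ws → CentralHead (head (pairs ws gs))
  pairs-head {[]} gs _ = tt
  pairs-head {w ∷ ws} [] _ = tt
  pairs-head {w ∷ ws} (g ∷ gs) (w²≡e ∷ _) = w , refl , w²≡e

  pairs-linked : ∀ {ws} gs → All (λ w → sq w ≡ e) ws → Linked Comm (pairs ws gs)
  pairs-linked {[]} gs _ = []
  pairs-linked {w ∷ ws} [] _ = []
  pairs-linked {w ∷ ws} (g ∷ gs) (w²≡e ∷ ws-central) =
    connect-from-central w²≡e _ ∷′ Linked.++⁺ (sameSquare-linked (class g) (All.tabulate (∈-class⁻ g)))
                                         (connect-to-central (pairs-head gs ws-central) _)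
                                         (pairs-linked gs ws-central)

  AllCentral : List (Fin n) → Set
  AllCentral = All (λ w → sq w ≡ e)

  -- (v,1), the other rotations, then |gs| pairs "central rotation, class":
  -- a path with n + |gs|·m vertices
  rotationPath : ∀ v prefix ws gs → Unique (v ∷ prefix ++ ws) → length (v ∷ prefix ++ ws) ≡ n →
                 AllCentral ws → Distinct gs → length ws ≡ length gs →
                 PathFrom (rot v) (n + length gs * m)
  rotationPath v prefix ws gs rotations! rotations-length ws-central gs-distinct ws≡gs =
    map rot prefix ++ pairs ws gs , (linked , unique-from-parts path (subst Unique (sym rots≡) rotations!)
                                                     (subst Unique (sym refs≡) (unique-classesOf gs gs-distinct))) ,
    path-length
    where
    open ≡-Reasoning
    path : List D
    path = map rot (v ∷ prefix) ++ pairs ws gs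
    linked : Linked Comm path
    linked = Linked.++⁺ (rotations-linked (v ∷ prefix)) (connect-to-central (pairs-head gs ws-central) _)
                        (pairs-linked gs ws-central)
    rots≡ : rots path ≡ v ∷ prefix ++ ws
    rots≡ = begin
      rots path                                          ≡⟨ rots-++ (map rot (v ∷ prefix)) (pairs ws gs) ⟩
      rots (map rot (v ∷ prefix)) ++ rots (pairs ws gs)  ≡⟨ cong₂ _++_ (rots-rot (v ∷ prefix)) (rots-pairs ws gs ws≡gs) ⟩
      (v ∷ prefix) ++ ws                                 ∎
    refs≡ : refs path ≡ classesOf gs
    refs≡ = begin
      refs path                                          ≡⟨ refs-++ (map rot (v ∷ prefix)) (pairs ws gs) ⟩
      refs (map rot (v ∷ prefix)) ++ refs (pairs ws gs)  ≡⟨ cong₂ _++_ (refs-rot (v ∷ prefix)) (refs-pairs ws gs ws≡gs) ⟩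
      classesOf gs                                       ∎
    path-length : length path ≡ n + length gs * m
    path-length = begin
      length path                                ≡⟨ length-rots-refs path ⟩
      length (rots path) + length (refs path)    ≡⟨ cong₂ _+_ (trans (cong length rots≡) rotations-length)
                                                              (trans (cong length refs≡) (length-classesOf gs)) ⟩
      n + length gs * m                          ∎

  -- (g,-1) and the rest of its class, then |gs| pairs "central rotation, class",
  -- then all rotations starting with a central one: a path with n + m + |gs|·m vertices
  reflectionPath : ∀ g ws w rest gs → Unique (ws ++ w ∷ rest) → length (ws ++ w ∷ rest) ≡ n →
                   AllCentral (w ∷ ws) → Distinct (g ∷ gs) → length ws ≡ length gs →
                   PathFrom (ref g) (n + (m + length gs * m))
  reflectionPath g ws w rest gs rotations! rotations-length (w²≡e ∷ ws-central) (g²∉ ∷ gs!) ws≡gs =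
    map ref (remove g (class g)) ++ tail ,
    (linked , unique-from-parts path (subst Unique (sym rots≡) rotations!) (subst Unique (sym refs≡) refs!)) ,
    path-length
    where
    open ≡-Reasoning
    own : List (Fin n)
    own = g ∷ remove g (class g)
    tail : List D
    tail = pairs ws gs ++ map rot (w ∷ rest)
    path : List D
    path = map ref own ++ tail
    own-squares : All (λ h → sq h ≡ sq g) own
    own-squares = refl ∷ All.tabulate (λ h∈ → ∈-class⁻ g (remove-⊆ (class g) h∈))
    linked : Linked Comm path
    linked = Linked.++⁺ (sameSquare-linked own own-squares)
               (connect-to-central (head-++ (pairs ws gs) _ (pairs-head gs ws-central) (w , refl , w²≡e)) _)
               (Linked.++⁺ (pairs-linked gs ws-central) (connect-to-central (w , refl , w²≡e) _)
                           (rotations-linked (w ∷ rest)))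
    rots≡ : rots path ≡ ws ++ w ∷ rest
    rots≡ = begin
      rots path                                        ≡⟨ rots-++ (map ref own) tail ⟩
      rots (map ref own) ++ rots tail                  ≡⟨ cong (_++ rots tail) (rots-ref own) ⟩
      rots tail                                        ≡⟨ rots-++ (pairs ws gs) (map rot (w ∷ rest)) ⟩
      rots (pairs ws gs) ++ rots (map rot (w ∷ rest))  ≡⟨ cong₂ _++_ (rots-pairs ws gs ws≡gs) (rots-rot (w ∷ rest)) ⟩
      ws ++ w ∷ rest                                   ∎
    refs≡ : refs path ≡ own ++ classesOf gs
    refs≡ = begin
      refs path                                        ≡⟨ refs-++ (map ref own) tail ⟩
      refs (map ref own) ++ refs tail                  ≡⟨ cong₂ _++_ (refs-ref own) (refs-++ (pairs ws gs) (map rot (w ∷ rest))) ⟩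
      own ++ (refs (pairs ws gs) ++ refs (map rot (w ∷ rest)))
                                                       ≡⟨ cong (own ++_) (cong₂ _++_ (refs-pairs ws gs ws≡gs) (refs-rot (w ∷ rest))) ⟩
      own ++ (classesOf gs ++ [])                      ≡⟨ cong (own ++_) (++-identityʳ (classesOf gs)) ⟩
      own ++ classesOf gs                              ∎
    refs! : Unique (own ++ classesOf gs)
    refs! = Unique.++⁺ (unique-∷-remove (unique-class g)) (unique-classesOf gs gs!)
              (λ (h∈own , h∈rest) → All.lookup g²∉ (∈-classesOf⁻ gs h∈rest) (sym (All.lookup own-squares h∈own)))
    own-length : length own ≡ m
    own-length = trans (length-remove (unique-class g) (∈-class⁺ g refl)) (length-class g)
    path-length : length path ≡ n + (m + length gs * m)
    path-length = begin
      length path                                ≡⟨ length-rots-refs path ⟩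
      length (rots path) + length (refs path)    ≡⟨ cong₂ _+_ (trans (cong length rots≡) rotations-length) (cong length refs≡) ⟩
      n + length (own ++ classesOf gs)           ≡⟨ cong (n +_) (trans (length-++ own) (cong₂ _+_ own-length (length-classesOf gs))) ⟩
      n + (m + length gs * m)                    ∎

  -- spare central rotations available after starting at (v,1)
  spare : Fin n → ℕ
  spare v = length (remove v involutions)

  spare-central : ∀ {v} → sq v ≡ e → suc (spare v) ≡ m
  spare-central v²≡e = length-remove unique-involutions (∈-involutions⁺ v²≡e)

  spare-noncentral : ∀ {v} → sq v ≢ e → spare v ≡ m
  spare-noncentral {v} v²≢e =
    cong length (filter-all (λ y → ¬? (y ≟ v)) (All.tabulate (λ { y∈K refl → v²≢e (∈-involutions⁻ y∈K) })))

  rotationWithClasses : ∀ v gs → Distinct gs → length gs ≤ spare v → PathFrom (rot v) (n + length gs * m)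
  rotationWithClasses v gs gs! gs≤spare with suffixOfLength (length gs) (remove v involutions) gs≤spare
  ... | ys , ws , ys++ws≡ , ws-length =
    rotationPath v (remove v others ++ ys) ws gs
      (subst (λ zs → Unique (v ∷ zs)) (sym listing≡) (unique-∷-remove unique-others++K))
      (trans (cong (λ zs → length (v ∷ zs)) listing≡)
             (trans (length-remove unique-others++K (∈-others++K v)) length-others++K))
      (All.tabulate (λ w∈ → ∈-involutions⁻ (remove-⊆ involutions (subst (_ ∈_) ys++ws≡ (∈-++⁺ʳ ys w∈)))))
      gs! ws-length
    where
    open ≡-Reasoning
    listing≡ : (remove v others ++ ys) ++ ws ≡ remove v (others ++ involutions)
    listing≡ = begin
      (remove v others ++ ys) ++ ws               ≡⟨ ++-assoc (remove v others) ys ws ⟩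
      remove v others ++ (ys ++ ws)               ≡⟨ cong (remove v others ++_) ys++ws≡ ⟩
      remove v others ++ remove v involutions     ≡⟨ filter-++ (λ y → ¬? (y ≟ v)) others involutions ⟨
      remove v (others ++ involutions)            ∎

  reflectionWithClasses : ∀ g gs → Distinct (g ∷ gs) → length gs < m → PathFrom (ref g) (n + (m + length gs * m))
  reflectionWithClasses g gs gs! gs<m with splitAt< (length gs) involutions gs<m
  ... | ws , w , zs , listing≡ , ws-length =
    reflectionPath g ws w (zs ++ others) gs
      (subst Unique (sym rotations≡) unique-K++others)
      (trans (cong length rotations≡) length-K++others)
      (central-in (∈-++⁺ʳ ws (here refl)) ∷ All.tabulate (λ w∈ → central-in (∈-++⁺ˡ w∈)))
      gs! ws-length
    where
    rotations≡ : ws ++ w ∷ zs ++ others ≡ involutions ++ others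
    rotations≡ = trans (sym (++-assoc ws (w ∷ zs) others)) (cong (_++ others) listing≡)
    central-in : ∀ {h} → h ∈ ws ++ w ∷ zs → sq h ≡ e
    central-in h∈ = ∈-involutions⁻ (subst (_ ∈_) listing≡ h∈)

  -- Choosing classes: every family of distinct classes extends to one covering G,
  -- hence n = q·m for the number q of classes

  Covers : List (Fin n) → Set
  Covers gs = ∀ x → sq x ∈ map sq gs

  distinct-bound : ∀ gs → Distinct gs → length gs * m ≤ n
  distinct-bound gs gs! = subst (_≤ n) (length-classesOf gs) (unique⇒length≤n (unique-classesOf gs gs!))

  covers-bound : ∀ gs → Covers gs → n ≤ length gs * m
  covers-bound gs covers = begin
    n                          ≡⟨ length-allFin ⟨
    length (allFin n)          ≤⟨ unique⊆⇒length≤ (Unique.allFin⁺ n) (λ {x} _ → ∈-classesOf⁺ gs (covers x)) ⟩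
    length (classesOf gs)      ≡⟨ length-classesOf gs ⟩
    length gs * m              ∎
    where open ≤-Reasoning

  distinct-take : ∀ j gs → Distinct gs → Distinct (take j gs)
  distinct-take j gs gs! = subst Unique (take-map j gs) (Unique.take⁺ j gs!)

  distinct-snoc : ∀ {x} gs → Distinct gs → sq x ∉ map sq gs → Distinct (gs ++ x ∷ [])
  distinct-snoc {x} gs gs! x-new = subst Unique (sym (map-++ sq gs (x ∷ [])))
    (Unique.++⁺ gs! ([] ∷ []) (λ { (x²∈ , here refl) → x-new x²∈ }))

  extend : ∀ fuel gs → Distinct gs → ∃[ new ] (Distinct (gs ++ new) × (Covers (gs ++ new) ⊎ fuel ≤ length new))
  extend zero gs gs! = [] , subst Distinct (sym (++-identityʳ gs)) gs! , inj₂ z≤n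
  extend (suc fuel) gs gs! with All.all? (λ x → sq x ∈? map sq gs) (allFin n)
  ... | yes all-covered =
    [] , subst Distinct (sym (++-identityʳ gs)) gs! ,
    inj₁ (λ x → subst (λ hs → sq x ∈ map sq hs) (sym (++-identityʳ gs)) (All.lookup all-covered (∈-allFin x)))
  ... | no ¬all-covered with Any.satisfied (All.¬All⇒Any¬ (λ x → sq x ∈? map sq gs) (allFin n) ¬all-covered)
  ...   | x , x-new with extend fuel (gs ++ x ∷ []) (distinct-snoc gs gs! x-new)
  ...     | new , gs+x+new! , result =
    x ∷ new , subst Distinct reassoc gs+x+new! , Sum.map (subst Covers reassoc) s≤s result
    where
    reassoc : (gs ++ x ∷ []) ++ new ≡ gs ++ x ∷ new
    reassoc = ++-assoc gs (x ∷ []) new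

  -- with fuel n + 1 the extension must cover G, as a distinct family has ≤ n members
  complete : ∀ gs → Distinct gs → ∃[ new ] (Distinct (gs ++ new) × length (gs ++ new) * m ≡ n)
  complete gs gs! with extend (suc n) gs gs!
  ... | new , all! , inj₁ covers = new , all! , ≤-antisym (distinct-bound _ all!) (covers-bound _ covers)
  ... | new , all! , inj₂ n<new = contradiction (begin-strict
    n                           <⟨ n<new ⟩
    length new                  ≤⟨ length-++-≤ʳ new {gs} ⟩
    length (gs ++ new)          ≤⟨ m≤m*n (length (gs ++ new)) m {{>-nonZero 0<m}} ⟩
    length (gs ++ new) * m      ≤⟨ distinct-bound (gs ++ new) all! ⟩
    n                           ∎) (<-irrefl refl)
    where open ≤-Reasoning

  -- D(G) non-abelian means some element of G does not square to e, so K ≠ G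
  nonAbelian⇒m<n : NonAbelianD → m < n
  nonAbelian⇒m<n (u , v , u⊙v≢v⊙u) with All.all? (λ g → sq g ≟ e) (allFin n)
  ... | yes all = contradiction (allSquaresTrivial⇒abelian (λ g → All.lookup all (∈-allFin g)) u v) u⊙v≢v⊙u
  ... | no ¬all with Any.satisfied (All.¬All⇒Any¬ (λ g → sq g ≟ e) (allFin n) ¬all)
  ...   | g₀ , g₀²≢e = ≤-trans (unique⊆⇒length≤ {xs = g₀ ∷ involutions} g₀∷K! (λ {x} _ → ∈-allFin x))
                                 (≤-reflexive length-allFin)
    where
    g₀∷K! : Unique (g₀ ∷ involutions)
    g₀∷K! = All.tabulate (λ { g∈K refl → g₀²≢e (∈-involutions⁻ g∈K) }) ∷ unique-involutions

  module Cases (m<n : m < n) where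

    private
      nonZero-m : NonZero m
      nonZero-m = >-nonZero 0<m

    -- one element from each class; there are q of them and q·m = n
    representatives : List (Fin n)
    representatives = proj₁ (complete [] [])

    representatives! : Distinct representatives
    representatives! = proj₁ (proj₂ (complete [] []))

    q : ℕ
    q = length representatives

    q*m≡n : q * m ≡ n
    q*m≡n = proj₂ (proj₂ (complete [] []))

    chooseClasses : ∀ j → j ≤ q → ∃[ gs ] (Distinct gs × length gs ≡ j)
    chooseClasses j j≤q = take j representatives , distinct-take j _ representatives! ,
                          trans (length-take j representatives) (m≤n⇒m⊓n≡m j≤q)

    -- there are at least two classes, so 2m ≤ n
    2m≤n : 2 * m ≤ n
    2m≤n = subst (2 * m ≤_) q*m≡n (*-monoˡ-≤ m 2≤q)
      where
      2≤q : 2 ≤ q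
      2≤q = *-cancelʳ-< m 1 q (subst₂ _<_ (sym (*-identityˡ m)) (sym q*m≡n) m<n)

    2n≡n+n : 2 * n ≡ n + n
    2n≡n+n = cong (n +_) (+-identityʳ n)

    -- v ∈ Ω₁, n < m²: fewer classes than spare central rotations, so all q classes fit
    centralSmall : ∀ {v} → sq v ≡ e → n < m * m → IsDetourEcc (rot v) (2 * n ∸ 1)
    centralSmall {v} v²≡e n<m² = detourEcc (rot v) (2 * n) (trivialBound (rot v))
      (subst (PathFrom (rot v)) (trans (cong (n +_) q*m≡n) (sym 2n≡n+n))
        (rotationWithClasses v representatives representatives! q≤spare))
      where
      q<m : q < m
      q<m = *-cancelʳ-< m q m (subst (_< m * m) (sym q*m≡n) n<m²)
      q≤spare : q ≤ spare v
      q≤spare = m<1+n⇒m≤n (subst (q <_) (sym (spare-central v²≡e)) q<m)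

    -- v ∈ Ω₁, m² ≤ n: the m - 1 spare central rotations each introduce a class
    centralLarge : ∀ {v} → sq v ≡ e → m * m ≤ n → IsDetourEcc (rot v) (n + m * (m ∸ 1) ∸ 1)
    centralLarge {v} v²≡e m²≤n with chooseClasses (m ∸ 1) (<⇒≤ m∸1<q)
      where
      m∸1<q : m ∸ 1 < q
      m∸1<q = *-cancelʳ-< m (m ∸ 1) q (<-≤-trans (*-monoˡ-< m {{nonZero-m}} (∸-monoʳ-< z<s 0<m))
                                                   (subst (m * m ≤_) (sym q*m≡n) m²≤n))
    ... | gs , gs! , gs-length = detourEcc (rot v) _ (centralBound v²≡e 2m≤n)
      (subst (PathFrom (rot v)) (cong (n +_) (trans (cong (_* m) gs-length) (*-comm (m ∸ 1) m)))
        (rotationWithClasses v gs gs! (≤-reflexive (trans gs-length (cong (_∸ 1) (sym (spare-central v²≡e)))))))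

    -- v ∈ Ω₂, n ≤ m²: all m central rotations are spare, and all q classes fit
    noncentralSmall : ∀ {v} → sq v ≢ e → n ≤ m * m → IsDetourEcc (rot v) (2 * n ∸ 1)
    noncentralSmall {v} v²≢e n≤m² = detourEcc (rot v) (2 * n) (trivialBound (rot v))
      (subst (PathFrom (rot v)) (trans (cong (n +_) q*m≡n) (sym 2n≡n+n))
        (rotationWithClasses v representatives representatives! q≤spare))
      where
      q≤spare : q ≤ spare v
      q≤spare = subst (q ≤_) (sym (spare-noncentral v²≢e))
                  (*-cancelʳ-≤ q m m {{nonZero-m}} (subst (_≤ m * m) (sym q*m≡n) n≤m²))

    -- v ∈ Ω₂, m² < n: m classes, one after each central rotation
    noncentralLarge : ∀ {v} → sq v ≢ e → m * m < n → IsDetourEcc (rot v) (n + m * m ∸ 1)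
    noncentralLarge {v} v²≢e m²<n with chooseClasses m (<⇒≤ (*-cancelʳ-< m m q (subst (m * m <_) (sym q*m≡n) m²<n)))
    ... | gs , gs! , gs-length = detourEcc (rot v) _ (noncentralBound v²≢e)
      (subst (PathFrom (rot v)) (cong (λ j → n + j * m) gs-length)
        (rotationWithClasses v gs gs! (≤-reflexive (trans gs-length (sym (spare-noncentral v²≢e))))))

    -- v = (g,-1), n ≤ m²: g's class and all q - 1 others; one central rotation is left
    -- to lead back to the rotations
    reflectionSmall : ∀ g → n ≤ m * m → IsDetourEcc (ref g) (2 * n ∸ 1)
    reflectionSmall g n≤m² with complete (g ∷ []) ([] ∷ [])
    ... | hs , g∷hs! , [1+hs]*m≡n = detourEcc (ref g) (2 * n) (trivialBound (ref g))
      (subst (PathFrom (ref g)) (trans (cong (n +_) [1+hs]*m≡n) (sym 2n≡n+n))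
        (reflectionWithClasses g hs g∷hs! (*-cancelʳ-≤ (suc (length hs)) m m {{nonZero-m}}
                                             (subst (_≤ m * m) (sym [1+hs]*m≡n) n≤m²))))

    -- v = (g,-1), m² < n: g's class and m - 1 others
    reflectionLarge : ∀ g → m * m < n → IsDetourEcc (ref g) (n + m * m ∸ 1)
    reflectionLarge g m²<n with complete (g ∷ []) ([] ∷ [])
    ... | hs , g∷hs! , [1+hs]*m≡n = detourEcc (ref g) _ (reflectionBound g 2m≤n)
      (subst (PathFrom (ref g)) (cong (n +_) (trans (cong (m +_) (trans (cong (_* m) gs-length) (*-comm (m ∸ 1) m)))
                                                    (m+m*[m∸1]≡m*m m)))
        (reflectionWithClasses g gs (distinct-take (suc (m ∸ 1)) (g ∷ hs) g∷hs!)
                               (subst (_< m) (sym gs-length) (∸-monoʳ-< z<s 0<m))))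
      where
      m≤hs : m ≤ length hs
      m≤hs = m<1+n⇒m≤n (*-cancelʳ-< m m (suc (length hs)) (subst (m * m <_) (sym [1+hs]*m≡n) m²<n))
      gs : List (Fin n)
      gs = take (m ∸ 1) hs
      gs-length : length gs ≡ m ∸ 1
      gs-length = trans (length-take (m ∸ 1) hs) (m≤n⇒m⊓n≡m (≤-trans (m∸n≤m m 1) m≤hs))

  eccentricities : NonAbelianD →
    (∀ g → sq g ≡ e →
      (n < m * m → IsDetourEcc (rot g) (2 * n ∸ 1)) ×
      (m * m ≤ n → IsDetourEcc (rot g) (n + m * (m ∸ 1) ∸ 1))) ×
    (∀ g → sq g ≢ e →
      (n ≤ m * m → IsDetourEcc (rot g) (2 * n ∸ 1)) ×
      (m * m < n → IsDetourEcc (rot g) (n + m * m ∸ 1))) ×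
    (∀ g →
      (n ≤ m * m → IsDetourEcc (ref g) (2 * n ∸ 1)) ×
      (m * m < n → IsDetourEcc (ref g) (n + m * m ∸ 1)))
  eccentricities nonAbelian =
    (λ g g²≡e → centralSmall g²≡e , centralLarge g²≡e) ,
    (λ g g²≢e → noncentralSmall g²≢e , noncentralLarge g²≢e) ,
    (λ g → reflectionSmall g , reflectionLarge g)
    where open Cases (nonAbelian⇒m<n nonAbelian)

4^r≡2^r*2^r : ∀ r → 4 ^ r ≡ 2 ^ r * 2 ^ r
4^r≡2^r*2^r zero = refl
4^r≡2^r*2^r (suc r) = trans (cong (4 *_) (4^r≡2^r*2^r r)) (square-double (2 ^ r))
  where
  square-double : ∀ x → 4 * (x * x) ≡ (2 * x) * (2 * x)
  square-double = solve-∀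

-- With m = 2^r = |K| and 4^r = m², the theorem is the statement `eccentricities`.
theorem3p1 : (n : ℕ) (_∙_ : Fin n → Fin n → Fin n) (e : Fin n) (_⁻¹ : Fin n → Fin n) →
    IsAbelianGroup _≡_ _∙_ e _⁻¹ →
    Dihedral.NonAbelianD _∙_ e _⁻¹ →
    (r : ℕ) → 2 ^ r ≡ Dihedral.involCount _∙_ e _⁻¹ →
    -- v ∈ Ω₁
    (∀ g → g ∙ g ≡ e →
      (n < 2 ^ r * 2 ^ r → Dihedral.IsDetourEcc _∙_ e _⁻¹ (g , true) (2 * n ∸ 1)) ×
      (2 ^ r * 2 ^ r ≤ n → Dihedral.IsDetourEcc _∙_ e _⁻¹ (g , true) (n + 2 ^ r * (2 ^ r ∸ 1) ∸ 1))) ×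
    -- v ∈ Ω₂
    (∀ g → g ∙ g ≢ e →
      (n ≤ 2 ^ r * 2 ^ r → Dihedral.IsDetourEcc _∙_ e _⁻¹ (g , true) (2 * n ∸ 1)) ×
      (2 ^ r * 2 ^ r < n → Dihedral.IsDetourEcc _∙_ e _⁻¹ (g , true) (n + 4 ^ r ∸ 1))) ×
    -- v ∈ Ω₃
    (∀ g →
      (n ≤ 2 ^ r * 2 ^ r → Dihedral.IsDetourEcc _∙_ e _⁻¹ (g , false) (2 * n ∸ 1)) ×
      (2 ^ r * 2 ^ r < n → Dihedral.IsDetourEcc _∙_ e _⁻¹ (g , false) (n + 4 ^ r ∸ 1)))
theorem3p1 n _∙_ e _⁻¹ isAbelian nonAbelian r 2^r≡m
  rewrite 4^r≡2^r*2^r r | 2^r≡m = DetourEccentricity.eccentricities _∙_ e _⁻¹ isAbelian nonAbelian
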